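{- Let $d\ge3$, $\mathcal A=\{0,\dots,d-1\}$, $\varphi$ the morphism $\varphi(i)=0(i+1)$ ($0\le i\le d-2$), $\varphi(d-1)=0(d-1)(d-1)$, and $\mathbf u$ its fixed point. Let $w$ be a bispecial factor of $\mathbf u$ such that at least two distinct letters smaller than $d-1$ are left extensions of $w$, and let $i=\min\{a\in\mathcal A: aw\in\mathcal L(\mathbf u)\}$. Then $w=F_i$ and $$\mathrm{Bext}(w)=\{(d-1)w(d-1)\}\cup\{iwk,\ kwi:\ k=i+1,i+2,\dots,d-1\}.$$ In particular, the bilateral order of $w=F_i$ equals $0$ and $i\le d-3$.
   Context: $\mathbf u$ is the unique infinite word starting with $0$ with $\varphi(\mathbf u)=\mathbf u$; $\mathcal L(\mathbf u)$ is its set of finite factors. A letter $a$ is a left (right) extension of a factor $w$ if $aw\in\mathcal L(\mathbf u)$ ($wa\in\mathcal L(\mathbf u)$); $w$ is bispecial if it has at least two left and at least two right extensions. $\mathrm{Bext}(w)=\{awb\in\mathcal L(\mathbf u): a,b\in\mathcal A\}$, and the bilateral order is $\mathrm b(w)=\#\mathrm{Bext}(w)-\#\{\text{left extensions}\}-\#\{\text{right extensions}\}+1$. The words $F_k$ are defined by $F_0=\varepsilon$ and $F_k=\varphi(F_{k-1})0$ for $k=1,\dots,d-1$. -}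

module Defs where

open import Data.Nat using (ℕ; zero; suc; _+_; _<?_)
open import Data.Fin using (Fin; toℕ; fromℕ<)
open import Data.List using (List; []; _∷_; _++_; [_]; map; concatMap; length; upTo)
open import Data.List.Relation.Unary.Unique.Propositional using (Unique)
open import Data.List.Membership.Propositional using (_∈_)
open import Data.Product using (Σ; _×_; ∃)
open import Function.Bundles using (_⇔_)
open import Relation.Nullary using (yes; no)
open import Relation.Binary.PropositionalEquality using (_≡_)
open import Data.Integer using (ℤ; +_; _-_) renaming (_+_ to _+ℤ_)
import Data.Fin
import Data.Empty

-- Alphabet A = {0,…,d-1} with d = suc m, represented by Fin (suc m).

φ-letter : {m : ℕ} → Fin (suc m) → List (Fin (suc m))
φ-letter {m} i with toℕ i <? m
... | yes p = Data.Fin.zero ∷ fromℕ< (Data.Nat.s≤s p) ∷ []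
... | no _  = Data.Fin.zero ∷ i ∷ i ∷ []

φ : {m : ℕ} → List (Fin (suc m)) → List (Fin (suc m))
φ = concatMap φ-letter

Word : ℕ → Set
Word m = ℕ → Fin (suc m)

slice : {m : ℕ} → Word m → ℕ → ℕ → List (Fin (suc m))
slice u n k = map (λ j → u (n + j)) (upTo k)

-- u starts with 0 and φ(u) = u (φ of every prefix of u is a prefix of u)
IsFixedPoint : {m : ℕ} → Word m → Set
IsFixedPoint u =
  (u 0 ≡ Data.Fin.zero) ×
  ((n : ℕ) → φ (slice u 0 n) ≡ slice u 0 (length (φ (slice u 0 n))))

_∈L_ : {m : ℕ} → List (Fin (suc m)) → Word m → Set
w ∈L u = ∃ λ n → w ≡ slice u n (length w)

LeftExt : {m : ℕ} → Word m → List (Fin (suc m)) → Fin (suc m) → Set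
LeftExt u w a = (a ∷ w) ∈L u

RightExt : {m : ℕ} → Word m → List (Fin (suc m)) → Fin (suc m) → Set
RightExt u w b = (w ++ [ b ]) ∈L u

-- Bext(w) = {awb ∈ L(u)}, identified with the pairs (a , b)
BExt : {m : ℕ} → Word m → List (Fin (suc m)) → Fin (suc m) × Fin (suc m) → Set
BExt u w (a Data.Product., b) = (a ∷ w ++ [ b ]) ∈L u

Bispecial : {m : ℕ} → Word m → List (Fin (suc m)) → Set
Bispecial u w =
  w ∈L u ×
  (Σ _ λ a → Σ _ λ a' → (a ≡ a' → Data.Empty.⊥) × LeftExt u w a × LeftExt u w a') ×
  (Σ _ λ b → Σ _ λ b' → (b ≡ b' → Data.Empty.⊥) × RightExt u w b × RightExt u w b')

HasCard : {A : Set} → (A → Set) → ℕ → Set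
HasCard {A} P n =
  Σ (List A) λ xs → Unique xs × ((x : A) → (x ∈ xs) ⇔ P x) × (length xs ≡ n)

BilateralOrder : {m : ℕ} → Word m → List (Fin (suc m)) → ℤ → Set
BilateralOrder u w z =
  Σ ℕ λ nB → Σ ℕ λ nL → Σ ℕ λ nR →
    HasCard (BExt u w) nB × HasCard (LeftExt u w) nL × HasCard (RightExt u w) nR ×
    (z ≡ (((+ nB) - (+ nL)) - (+ nR)) +ℤ (+ 1))

F : {m : ℕ} → ℕ → List (Fin (suc m))
F zero = []
F (suc k) = φ (F k) ++ [ Data.Fin.zero ]

-- Every 0 in u begins one of the blocks φ(uₙ) of u = φ(u₀)φ(u₁)⋯, where φ(x) = 0(x+1) for x < d-1
-- and φ(d-1) = 0(d-1)(d-1). So a factor φ(v)0 occurs only at block boundaries and desubstitutes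
-- uniquely: a bilateral extension a·φ(v)0·b comes from an extension y·v·x, with a and b the second
-- letters of φ(y) and φ(x). The factors of length two are 0c, c0 (c ≠ 0) and (d-1)(d-1); from them,
-- induction on k gives Bext(F_k) = {(d-1)F_k(d-1)} ∪ {k F_k b, b F_k k : b > k} while k + 2 < d,
-- and counting gives b(F_k) = 0.
-- The classification is by induction on |w|. Two left extensions below d-1 force w to start with 0.
-- If w ends with 0, then w = φ(v)0 where v is again bispecial with two left extensions below d-1
-- (the predecessors of those of w), so v = F_k, w = F_(k+1), and these predecessors, which are ≥ k
-- and distinct, give k + 3 < d. If w ends with c ≠ 0, a nonzero right extension forces c = d-1, the
-- right extensions are then 0 and d-1, and w = φ(v)0(d-1); desubstituting, each left extension below d-1
-- of w comes from some y with y·F_k·x ∈ L and x ≥ d-2 > k, which forces y = k for both: impossible.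

module Submission where

open import Defs
open import Data.Nat using (ℕ; zero; suc; _+_; _∸_; _≤_; _<_; _<ᵇ_; z≤n; s≤s; s≤s⁻¹; z<s)
open import Data.Nat.Properties hiding (_≟_)
open import Data.Fin using (Fin; toℕ; fromℕ; fromℕ<; inject₁) renaming (zero to 0F; suc to 1+F)
open import Data.Fin.Properties
  using (_≟_; toℕ-injective; toℕ≤pred[n]; toℕ-fromℕ; toℕ-fromℕ<; toℕ-inject₁; toℕ<n; fromℕ<-toℕ)
import Data.Fin.Properties as Fin
open import Data.List using (List; []; _∷_; _++_; [_]; length; map; concat; applyUpTo; initLast; _∷ʳ′_)
open import Data.List.Properties
  using ( ++-assoc; ++-identityʳ; length-++; length-++-≤ˡ; length-++-≤ʳ; length-map; map-++; concat-++
        ; ∷-injective; ∷-injectiveˡ; ∷-injectiveʳ; map-upTo; applyUpTo-∷ʳ)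
open import Data.List.Membership.Propositional.Properties using (∈-map⁺; ∈-map⁻; ∈-++⁺ˡ; ∈-++⁺ʳ; ∈-++⁻)
open import Data.List.Relation.Unary.Any using (here; there)
import Data.List.Relation.Unary.All as All
import Data.List.Relation.Unary.AllPairs as AllPairs
import Data.List.Relation.Unary.Unique.Propositional.Properties as Unique
open import Data.Product using (Σ; _×_; _,_; proj₁; proj₂)
open import Data.Sum using (_⊎_; inj₁; inj₂)
import Data.Sum
open import Data.Empty using (⊥; ⊥-elim)
open import Data.Unit using (⊤; tt)
open import Data.Integer using (ℤ; 0ℤ)
import Data.Integer as ℤ
open import Data.Integer.Properties using (pos-+)
open import Data.Integer.Tactic.RingSolver using (solve-∀)
open import Relation.Binary.PropositionalEquality hiding ([_])
open import Relation.Binary.Definitions using (DecidableEquality)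
open import Relation.Nullary using (¬_; yes; no)
open import Relation.Nullary.Decidable.Core using (T?)
open import Function.Base using (_∘_)
open import Function.Bundles using (_⇔_; mk⇔; Equivalence)
open import Function.Construct.Composition using (_⇔-∘_)
open import Function.Construct.Symmetry using (⇔-sym)

++-substˡ : {X : Set} {xs xs' ys ys' zs zs' : List X} →
            xs ≡ xs' → ys ≡ ys' → xs ++ zs ≡ ys ++ zs' → xs' ++ zs ≡ ys' ++ zs'
++-substˡ refl refl e = e

∷ʳ-∷ʳ : {X : Set} (xs : List X) (a b : X) → (xs ++ [ a ]) ++ [ b ] ≡ xs ++ a ∷ b ∷ []
∷ʳ-∷ʳ xs a b = ++-assoc xs [ a ] [ b ]

∷ʳ-∷ʳ-∷ʳ : {X : Set} (xs : List X) (a b c : X) → ((xs ++ [ a ]) ++ [ b ]) ++ [ c ] ≡ xs ++ a ∷ b ∷ c ∷ []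
∷ʳ-∷ʳ-∷ʳ xs a b c = trans (cong (_++ [ c ]) (∷ʳ-∷ʳ xs a b)) (++-assoc xs (a ∷ b ∷ []) [ c ])

length-∷ʳ : {X : Set} (xs : List X) (x : X) → length (xs ++ [ x ]) ≡ suc (length xs)
length-∷ʳ xs x = trans (length-++ xs) (+-comm (length xs) 1)

subst-⇔ : {X : Set} (P : X → Set) {x y : X} → x ≡ y → P x ⇔ P y
subst-⇔ P refl = mk⇔ (λ p → p) (λ p → p)

HasCard-cong : {X : Set} {P Q : X → Set} {n : ℕ} → (∀ x → P x ⇔ Q x) → HasCard P n → HasCard Q n
HasCard-cong P⇔Q (xs , unique , ∈⇔P , len) =
  xs , unique , (λ x → mk⇔ (to (P⇔Q x) ∘ to (∈⇔P x)) (from (∈⇔P x) ∘ from (P⇔Q x))) , len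
  where open Equivalence

HasCard-≡ : {X : Set} (c : X) → HasCard (_≡ c) 1
HasCard-≡ c = [ c ] , All.[] AllPairs.∷ AllPairs.[] , (λ x → mk⇔ (λ { (here x≡c) → x≡c ; (there ()) }) (here)) , refl

HasCard-⊎ : {X : Set} {P Q : X → Set} {n n' : ℕ} → HasCard P n → HasCard Q n' → (∀ x → P x → Q x → ⊥) →
            HasCard (λ x → P x ⊎ Q x) (n + n')
HasCard-⊎ (xs , uxs , ∈xs , len) (ys , uys , ∈ys , len') disjoint =
  xs ++ ys ,
  Unique.++⁺ uxs uys (λ (x∈xs , x∈ys) → disjoint _ (to (∈xs _) x∈xs) (to (∈ys _) x∈ys)) ,
  (λ x → mk⇔ (Data.Sum.map (to (∈xs x)) (to (∈ys x)) ∘ ∈-++⁻ xs)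
             (Data.Sum.[ ∈-++⁺ˡ ∘ from (∈xs x) , ∈-++⁺ʳ xs ∘ from (∈ys x) ])) ,
  trans (length-++ xs) (cong₂ _+_ len len')
  where open Equivalence

HasCard-map : {X Y : Set} {P : X → Set} {n : ℕ} (f : X → Y) → (∀ {x x'} → f x ≡ f x' → x ≡ x') →
              HasCard P n → HasCard (λ y → Σ X λ x → P x × f x ≡ y) n
HasCard-map f f-injective (xs , uxs , ∈xs , len) =
  map f xs , Unique.map⁺ f-injective uxs ,
  (λ y → mk⇔ (λ y∈ → let x , x∈ , y≡ = ∈-map⁻ f y∈ in x , to (∈xs x) x∈ , sym y≡)
             (λ { (x , Px , refl) → ∈-map⁺ f (from (∈xs x) Px) })) ,
  trans (length-map f xs) len
  where open Equivalence

HasCard-≥ : ∀ n k → HasCard (λ (x : Fin n) → k ≤ toℕ x) (n ∸ k)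
HasCard-≥ zero k = [] , AllPairs.[] , (λ ()) , sym (0∸n≡0 k)
HasCard-≥ (suc n) zero =
  HasCard-cong (λ x → mk⇔ (λ _ → z≤n) (from x)) (HasCard-⊎ (HasCard-≡ 0F) (HasCard-map 1+F Fin.suc-injective (HasCard-≥ n 0)) disjoint)
  where
  from : ∀ x → 0 ≤ toℕ x → x ≡ 0F ⊎ Σ (Fin n) λ y → 0 ≤ toℕ y × 1+F y ≡ x
  from 0F _ = inj₁ refl
  from (1+F y) _ = inj₂ (y , z≤n , refl)
  disjoint : ∀ x → x ≡ 0F → (Σ (Fin n) λ y → 0 ≤ toℕ y × 1+F y ≡ x) → ⊥
  disjoint _ refl (_ , _ , ())
HasCard-≥ (suc n) (suc k) =
  HasCard-cong (λ x → mk⇔ to (from x)) (HasCard-map 1+F Fin.suc-injective (HasCard-≥ n k))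
  where
  to : ∀ {x} → (Σ (Fin n) λ y → k ≤ toℕ y × 1+F y ≡ x) → suc k ≤ toℕ x
  to (_ , k≤y , refl) = s≤s k≤y
  from : ∀ x → suc k ≤ toℕ x → Σ (Fin n) λ y → k ≤ toℕ y × 1+F y ≡ x
  from (1+F y) k₁≤ = y , s≤s⁻¹ k₁≤ , refl

bilateral-order-zero : ∀ t → (((ℤ.+ (1 + (t + t))) ℤ.- (ℤ.+ suc t)) ℤ.- (ℤ.+ suc t)) ℤ.+ ℤ.1ℤ ≡ ℤ.0ℤ
bilateral-order-zero t =
  trans (cong₂ (λ p q → ((p ℤ.- q) ℤ.- q) ℤ.+ ℤ.1ℤ)
               (trans (pos-+ 1 (t + t)) (cong (λ x → ℤ.1ℤ ℤ.+ x) (pos-+ t t))) (pos-+ 1 t))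
        (identity (ℤ.+ t))
  where
  identity : ∀ (x : ℤ) → (((ℤ.1ℤ ℤ.+ (x ℤ.+ x)) ℤ.- (ℤ.1ℤ ℤ.+ x)) ℤ.- (ℤ.1ℤ ℤ.+ x)) ℤ.+ ℤ.1ℤ ≡ ℤ.0ℤ
  identity = solve-∀

TwoDistinct : {X : Set} → (X → Set) → Set
TwoDistinct {X} P = Σ X λ x → Σ X λ x' → x ≢ x' × P x × P x'

TwoDistinct-map : {X : Set} {P Q : X → Set} → (∀ x → P x → Q x) → TwoDistinct P → TwoDistinct Q
TwoDistinct-map f (x , x' , x≢x' , p , p') = x , x' , x≢x' , f x p , f x' p'

TwoDistinct-pullback : {X Y : Set} {P : X → Set} {Q : Y → Set} (g : Y → X) →
  (∀ x → P x → Σ Y λ y → Q y × g y ≡ x) → TwoDistinct P → TwoDistinct Q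
TwoDistinct-pullback g pre (x , x' , x≢x' , p , p') with pre x p | pre x' p'
... | y , q , refl | y' , q' , refl = y , y' , (λ y≡y' → x≢x' (cong g y≡y')) , q , q'

TwoDistinct-avoid : {X : Set} {P : X → Set} → DecidableEquality X → TwoDistinct P → (c : X) → Σ X λ x → x ≢ c × P x
TwoDistinct-avoid _≟_ (x , x' , x≢x' , p , p') c with x ≟ c
... | no x≢c = x , x≢c , p
... | yes refl = x' , (λ x'≡x → x≢x' (sym x'≡x)) , p'

two-distinct-≥⇒2+< : ∀ {k p q n} → k ≤ p → k ≤ q → p ≢ q → suc p < n → suc q < n → suc (suc k) < n
two-distinct-≥⇒2+< k≤p k≤q p≢q p₁<n q₁<n with m≤n⇒m<n∨m≡n k≤p | m≤n⇒m<n∨m≡n k≤q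
... | inj₁ k<p | _ = ≤-<-trans (s≤s k<p) p₁<n
... | inj₂ _ | inj₁ k<q = ≤-<-trans (s≤s k<q) q₁<n
... | inj₂ refl | inj₂ refl = ⊥-elim (p≢q refl)

module Letters {m : ℕ} where

  A : Set
  A = Fin (suc m)

  top : A
  top = fromℕ m

  next : A → A
  next x = second (φ-letter x)
    where
    second : List A → A
    second (_ ∷ b ∷ _) = b
    second _ = x

  extra : A → List A
  extra x = drop₂ (φ-letter x)
    where
    drop₂ : List A → List A
    drop₂ (_ ∷ _ ∷ r) = r
    drop₂ _ = []

  -- φ-letter branches on toℕ x <? m, which unfolds to this T? test; abstracting it lets φ-letter compute.
  φ-letter-≡ : (x : A) → φ-letter x ≡ 0F ∷ next x ∷ extra x
  φ-letter-≡ x with T? (toℕ x <ᵇ m)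
  ... | yes _ = refl
  ... | no _ = refl

  short-letter : (x : A) → toℕ x < m → toℕ (next x) ≡ suc (toℕ x) × extra x ≡ []
  short-letter x x<m with T? (toℕ x <ᵇ m)
  ... | yes x<ᵇm = toℕ-fromℕ< (s≤s (<ᵇ⇒< _ _ x<ᵇm)) , refl
  ... | no x≮ᵇm = ⊥-elim (x≮ᵇm (<⇒<ᵇ x<m))

  top-letter : (x : A) → toℕ x ≡ m → next x ≡ x × extra x ≡ [ x ]
  top-letter x x≡m with T? (toℕ x <ᵇ m)
  ... | yes x<ᵇm = ⊥-elim (<⇒≢ (<ᵇ⇒< _ _ x<ᵇm) x≡m)
  ... | no _ = refl , refl

  toℕ≡m⇒≡top : {x : A} → toℕ x ≡ m → x ≡ top
  toℕ≡m⇒≡top x≡m = toℕ-injective (trans x≡m (sym (toℕ-fromℕ m)))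

  data Shape (x : A) : Set where
    short : toℕ x < m → toℕ (next x) ≡ suc (toℕ x) → extra x ≡ [] → Shape x
    long  : x ≡ top → next x ≡ x → extra x ≡ [ x ] → Shape x

  shape : (x : A) → Shape x
  shape x with m≤n⇒m<n∨m≡n (toℕ≤pred[n] x)
  ... | inj₁ x<m = let next≡ , extra≡ = short-letter x x<m in short x<m next≡ extra≡
  ... | inj₂ x≡m = let next≡ , extra≡ = top-letter x x≡m in long (toℕ≡m⇒≡top x≡m) next≡ extra≡

  next-top : next top ≡ top
  next-top = proj₁ (top-letter top (toℕ-fromℕ m))

  extra-top : extra top ≡ [ top ]
  extra-top = proj₂ (top-letter top (toℕ-fromℕ m))

  kth : ∀ k → k < m → A
  kth k k<m = fromℕ< (m<n⇒m<1+n k<m)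

  toℕ-kth : ∀ k (k<m : k < m) → toℕ (kth k k<m) ≡ k
  toℕ-kth k k<m = toℕ-fromℕ< (m<n⇒m<1+n k<m)

  k<toℕ-top : ∀ {k} → k < m → k < toℕ top
  k<toℕ-top k<m = subst (_ <_) (sym (toℕ-fromℕ m)) k<m

  0<⇒≢0F : (c : A) → 0 < toℕ c → c ≢ 0F
  0<⇒≢0F c 0<c refl = <-irrefl refl 0<c

  <m⇒≢top : (x : A) → toℕ x < m → x ≢ top
  <m⇒≢top x x<m x≡top = <⇒≢ x<m (trans (cong toℕ x≡top) (toℕ-fromℕ m))

  top≢0F : 1 ≤ m → top ≢ 0F
  top≢0F 1≤m top≡0 = <⇒≢ 1≤m (sym (trans (sym (toℕ-fromℕ m)) (cong toℕ top≡0)))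

  toℕ-next : (x : A) → toℕ x < m → toℕ (next x) ≡ suc (toℕ x)
  toℕ-next x x<m = proj₁ (short-letter x x<m)

  toℕ-next-< : (y : A) → toℕ (next y) < m → toℕ (next y) ≡ suc (toℕ y)
  toℕ-next-< y next<m with shape y
  ... | short _ next≡ _ = next≡
  ... | long refl next≡ _ = ⊥-elim (<m⇒≢top (next top) next<m next≡)

  next≡top⇒ : (x : A) → next x ≡ top → m ≤ suc (toℕ x)
  next≡top⇒ x next≡top with shape x
  ... | short _ next≡ _ = ≤-reflexive (trans (sym (toℕ-fromℕ m)) (trans (cong toℕ (sym next≡top)) next≡))
  ... | long refl _ _ = ≤-trans (≤-reflexive (sym (toℕ-fromℕ m))) (n≤1+n _)

  <-next : ∀ {k} (x : A) → k ≤ toℕ x → k < m → k < toℕ (next x)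
  <-next x k≤x k<m with shape x
  ... | short _ next≡ _ = subst (_ <_) (sym next≡) (s≤s k≤x)
  ... | long refl next≡ _ = subst (_ <_) (sym (trans (cong toℕ next≡) (toℕ-fromℕ m))) k<m

  next≢0F : 1 ≤ m → (x : A) → next x ≢ 0F
  next≢0F 1≤m x with shape x
  ... | short _ next≡ _ = λ e → 0≢1+n (trans (sym (cong toℕ e)) next≡)
  ... | long refl next≡ _ = top≢0F 1≤m ∘ trans (sym next≡)

  inject₁<m : (c : Fin m) → toℕ (inject₁ c) < m
  inject₁<m c = subst (_< m) (sym (toℕ-inject₁ c)) (toℕ<n c)

  next-inject₁ : (c : Fin m) → next (inject₁ c) ≡ 1+F c
  next-inject₁ c = toℕ-injective (trans (toℕ-next (inject₁ c) (inject₁<m c)) (cong suc (toℕ-inject₁ c)))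

  next-preimage : (c : A) → c ≢ 0F → Σ A λ y → toℕ y < m × next y ≡ c
  next-preimage 0F c≢0 = ⊥-elim (c≢0 refl)
  next-preimage (1+F c) _ = inject₁ c , inject₁<m c , next-inject₁ c

  next-preimage-ℕ : (c : A) → 0 < toℕ c → Σ A λ y → next y ≡ c × suc (toℕ y) ≡ toℕ c
  next-preimage-ℕ c 0<c with next-preimage c (0<⇒≢0F c 0<c)
  ... | y , y<m , refl = y , refl , sym (toℕ-next y y<m)

  φ-∷ : (x : A) (v : List A) → φ (x ∷ v) ≡ 0F ∷ next x ∷ extra x ++ φ v
  φ-∷ x v = cong (_++ φ v) (φ-letter-≡ x)

  φ-++ : (xs ys : List A) → φ (xs ++ ys) ≡ φ xs ++ φ ys
  φ-++ xs ys = trans (cong concat (map-++ φ-letter xs ys)) (sym (concat-++ (map φ-letter xs) (map φ-letter ys)))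

  φ-short-∷ : (x : A) (v : List A) → toℕ x < m → φ (x ∷ v) ≡ 0F ∷ next x ∷ φ v
  φ-short-∷ x v x<m = trans (φ-∷ x v) (cong (λ r → 0F ∷ next x ∷ r ++ φ v) (proj₂ (short-letter x x<m)))

  φ-top-∷ : (v : List A) → φ (top ∷ v) ≡ 0F ∷ top ∷ top ∷ φ v
  φ-top-∷ v = trans (φ-∷ top v) (cong₂ (λ b r → 0F ∷ b ∷ r ++ φ v) next-top extra-top)

  φ-letter-∷ʳ-next : (x : A) → φ-letter x ≡ 0F ∷ extra x ++ [ next x ]
  φ-letter-∷ʳ-next x with shape x
  ... | short _ _ extra≡ =
        trans (trans (φ-letter-≡ x) (cong (λ r → 0F ∷ next x ∷ r) extra≡))
              (sym (cong (λ r → 0F ∷ r ++ [ next x ]) extra≡))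
  ... | long refl next≡ extra≡ =
        trans (trans (φ-letter-≡ top) (cong₂ (λ b r → 0F ∷ b ∷ r) next≡ extra≡))
              (sym (cong₂ (λ r b → 0F ∷ r ++ [ b ]) extra≡ next≡))

  length-φ-∷ : (x : A) (v : List A) → length (φ (x ∷ v)) ≡ 2 + length (extra x) + length (φ v)
  length-φ-∷ x v = trans (cong length (φ-∷ x v)) (cong (2 +_) (length-++ (extra x)))

  φ-∷≢[] : (x : A) (v : List A) → φ (x ∷ v) ≢ []
  φ-∷≢[] x v e with trans (sym (φ-∷ x v)) e
  ... | ()

  φ-≢top∷ : 1 ≤ m → (v w : List A) → φ v ≢ top ∷ w
  φ-≢top∷ 1≤m [] w ()
  φ-≢top∷ 1≤m (x ∷ v) w e = top≢0F 1≤m (sym (∷-injectiveˡ (trans (sym (φ-∷ x v)) e)))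

  φ-∷-injective : 1 ≤ m → (x x' : A) (v v' : List A) → φ (x ∷ v) ≡ φ (x' ∷ v') → x ≡ x' × φ v ≡ φ v'
  φ-∷-injective 1≤m x x' v v' e
    with shape x | shape x' | ∷-injective (∷-injectiveʳ (trans (sym (φ-∷ x v)) (trans e (φ-∷ x' v'))))
  ... | short _ n≡ e≡ | short _ n'≡ e'≡ | next≡ , rest≡ =
        toℕ-injective (suc-injective (trans (sym n≡) (trans (cong toℕ next≡) n'≡))) , ++-substˡ e≡ e'≡ rest≡
  ... | short _ _ e≡ | long refl _ e'≡ | _ , rest≡ = ⊥-elim (φ-≢top∷ 1≤m v (φ v') (++-substˡ e≡ e'≡ rest≡))
  ... | long refl _ e≡ | short _ _ e'≡ | _ , rest≡ = ⊥-elim (φ-≢top∷ 1≤m v' (φ v) (sym (++-substˡ e≡ e'≡ rest≡)))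
  ... | long refl _ e≡ | long refl _ e'≡ | _ , rest≡ = refl , ∷-injectiveʳ (++-substˡ e≡ e'≡ rest≡)

  φ-injective : 1 ≤ m → (v v' : List A) → φ v ≡ φ v' → v ≡ v'
  φ-injective 1≤m [] [] _ = refl
  φ-injective 1≤m [] (x' ∷ v') e = ⊥-elim (φ-∷≢[] x' v' (sym e))
  φ-injective 1≤m (x ∷ v) [] e = ⊥-elim (φ-∷≢[] x v e)
  φ-injective 1≤m (x ∷ v) (x' ∷ v') e =
    let x≡x' , φv≡φv' = φ-∷-injective 1≤m x x' v v' e in cong₂ _∷_ x≡x' (φ-injective 1≤m v v' φv≡φv')

  length-≤-φ : (v : List A) → length v ≤ length (φ v)
  length-≤-φ [] = z≤n
  length-≤-φ (x ∷ v) rewrite φ-∷ x v =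
    s≤s (≤-trans (length-≤-φ v) (≤-trans (length-++-≤ʳ (φ v) {extra x}) (n≤1+n _)))

module FixedPoint {m : ℕ} (1≤m : 1 ≤ m) (u : Word m) (fp : IsFixedPoint u) where
  open Letters {m}

  OccursAt : ℕ → List A → Set
  OccursAt k [] = ⊤
  OccursAt k (x ∷ xs) = u k ≡ x × OccursAt (suc k) xs

  occurs-≡ : ∀ {j k} (w : List A) → j ≡ k → OccursAt j w → OccursAt k w
  occurs-≡ w refl o = o

  occurs-++⁻ : ∀ k (xs ys : List A) → OccursAt k (xs ++ ys) → OccursAt k xs × OccursAt (k + length xs) ys
  occurs-++⁻ k [] ys o = tt , occurs-≡ ys (sym (+-identityʳ k)) o
  occurs-++⁻ k (x ∷ xs) ys (ux , o) =
    let oxs , oys = occurs-++⁻ (suc k) xs ys o in (ux , oxs) , occurs-≡ ys (sym (+-suc k (length xs))) oys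

  occurs-++⁺ : ∀ k (xs ys : List A) → OccursAt k xs → OccursAt (k + length xs) ys → OccursAt k (xs ++ ys)
  occurs-++⁺ k [] ys _ o = occurs-≡ ys (+-identityʳ k) o
  occurs-++⁺ k (x ∷ xs) ys (ux , oxs) oys = ux , occurs-++⁺ (suc k) xs ys oxs (occurs-≡ ys (+-suc k (length xs)) oys)

  occurs-applyUpTo : ∀ (f : ℕ → A) n → (∀ j → f j ≡ u (n + j)) → ∀ k → OccursAt n (applyUpTo f k)
  occurs-applyUpTo f n f≗ zero = tt
  occurs-applyUpTo f n f≗ (suc k) =
    sym (trans (f≗ 0) (cong u (+-identityʳ n))) ,
    occurs-applyUpTo (f ∘ suc) (suc n) (λ j → trans (f≗ (suc j)) (cong u (+-suc n j))) k

  occurs⇒≡applyUpTo : ∀ (f : ℕ → A) n → (∀ j → f j ≡ u (n + j)) → ∀ w → OccursAt n w → w ≡ applyUpTo f (length w)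
  occurs⇒≡applyUpTo f n f≗ [] _ = refl
  occurs⇒≡applyUpTo f n f≗ (x ∷ w) (ux , o) =
    cong₂ _∷_ (trans (sym ux) (sym (trans (f≗ 0) (cong u (+-identityʳ n)))))
              (occurs⇒≡applyUpTo (f ∘ suc) (suc n) (λ j → trans (f≗ (suc j)) (cong u (+-suc n j))) w o)

  occurs-slice : ∀ n k → OccursAt n (slice u n k)
  occurs-slice n k = subst (OccursAt n) (sym (map-upTo _ k)) (occurs-applyUpTo _ n (λ _ → refl) k)

  ∈L⇒occurs : {w : List A} → w ∈L u → Σ ℕ λ n → OccursAt n w
  ∈L⇒occurs {w} (n , w≡) = n , subst (OccursAt n) (sym w≡) (occurs-slice n (length w))

  occurs⇒∈L : ∀ {n} (w : List A) → OccursAt n w → w ∈L u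
  occurs⇒∈L {n} w o = n , trans (occurs⇒≡applyUpTo _ n (λ _ → refl) w o) (sym (map-upTo _ (length w)))

  ∈L-prefix : (xs ys : List A) → (xs ++ ys) ∈L u → xs ∈L u
  ∈L-prefix xs ys l = let n , o = ∈L⇒occurs l in occurs⇒∈L xs (proj₁ (occurs-++⁻ n xs ys o))

  ∈L-suffix : (xs ys : List A) → (xs ++ ys) ∈L u → ys ∈L u
  ∈L-suffix xs ys l = let n , o = ∈L⇒occurs l in occurs⇒∈L ys (proj₂ (occurs-++⁻ n xs ys o))

  ∈L-infix : (xs ys zs : List A) → (xs ++ ys ++ zs) ∈L u → ys ∈L u
  ∈L-infix xs ys zs = ∈L-prefix ys zs ∘ ∈L-suffix xs (ys ++ zs)

  ∈L-extendʳ : (w : List A) → w ∈L u → Σ A λ b → (w ++ [ b ]) ∈L u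
  ∈L-extendʳ w l = let n , o = ∈L⇒occurs l in
    u (n + length w) , occurs⇒∈L (w ++ [ _ ]) (occurs-++⁺ n w [ u (n + length w) ] o (refl , tt))

  -- The decomposition u = φ(u₀)φ(u₁)φ(u₂)⋯
  occurs-φ-prefix : ∀ n → OccursAt 0 (φ (applyUpTo u n))
  occurs-φ-prefix n =
    subst (λ p → OccursAt 0 (φ p)) (map-upTo _ n)
      (subst (OccursAt 0) (sym (proj₂ fp n)) (occurs-slice 0 _))

  start : ℕ → ℕ
  start n = length (φ (applyUpTo u n))

  φ-prefix-suc : ∀ n → φ (applyUpTo u (suc n)) ≡ φ (applyUpTo u n) ++ φ-letter (u n)
  φ-prefix-suc n = begin
    φ (applyUpTo u (suc n))              ≡⟨ cong φ (sym (applyUpTo-∷ʳ u n)) ⟩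
    φ (applyUpTo u n ++ [ u n ])         ≡⟨ φ-++ (applyUpTo u n) [ u n ] ⟩
    φ (applyUpTo u n) ++ φ [ u n ]       ≡⟨ cong (φ (applyUpTo u n) ++_) (++-identityʳ (φ-letter (u n))) ⟩
    φ (applyUpTo u n) ++ φ-letter (u n)  ∎
    where open ≡-Reasoning

  start-suc : ∀ n → start (suc n) ≡ start n + (2 + length (extra (u n)))
  start-suc n = trans (cong length (φ-prefix-suc n))
                      (trans (length-++ (φ (applyUpTo u n))) (cong (λ b → start n + length b) (φ-letter-≡ (u n))))

  occurs-block : ∀ n → OccursAt (start n) (0F ∷ next (u n) ∷ extra (u n))
  occurs-block n = subst (OccursAt (start n)) (φ-letter-≡ (u n))
    (proj₂ (occurs-++⁻ 0 (φ (applyUpTo u n)) (φ-letter (u n))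
             (subst (OccursAt 0) (φ-prefix-suc n) (occurs-φ-prefix (suc n)))))

  u-start : ∀ n → u (start n) ≡ 0F
  u-start n = proj₁ (occurs-block n)

  data Block (n : ℕ) : Set where
    short : toℕ (u n) < m → u (1 + start n) ≡ next (u n) → start (suc n) ≡ 2 + start n → Block n
    long  : u n ≡ top → u (1 + start n) ≡ top → u (2 + start n) ≡ top → start (suc n) ≡ 3 + start n → Block n

  block : ∀ n → Block n
  block n with shape (u n) | occurs-block n
  ... | short u<m _ extra≡ | _ , u₁ , _ =
        short u<m u₁ (trans (start-suc n) (trans (cong (λ r → start n + (2 + length r)) extra≡) (+-comm (start n) 2)))
  ... | long u≡top next≡ extra≡ | _ , u₁ , o =
        long u≡top (trans u₁ (trans next≡ u≡top))
             (trans (proj₁ (subst (OccursAt (2 + start n)) extra≡ o)) u≡top)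
             (trans (start-suc n) (trans (cong (λ r → start n + (2 + length r)) extra≡) (+-comm (start n) 3)))

  u-second≢0F : ∀ n → u (1 + start n) ≢ 0F
  u-second≢0F n with block n
  ... | short _ u₁ _ = next≢0F 1≤m (u n) ∘ trans (sym u₁)
  ... | long _ u₁ _ _ = top≢0F 1≤m ∘ trans (sym u₁)

  data InBlock (j n : ℕ) : Set where
    first  : j ≡ start n → InBlock j n
    second : j ≡ 1 + start n → InBlock j n
    third  : j ≡ 2 + start n → u j ≡ top → suc j ≡ start (suc n) → InBlock j n

  inBlock : ∀ j → Σ ℕ (InBlock j)
  inBlock zero = 0 , first refl
  inBlock (suc j) with inBlock j
  ... | n , first j≡ = n , second (cong suc j≡)
  ... | n , third _ _ s≡ = suc n , first s≡
  ... | n , second j≡ with block n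
  ...   | short _ _ s≡ = suc n , first (trans (cong suc j≡) (sym s≡))
  ...   | long _ _ u₂ s≡ = n , third (cong suc j≡) (trans (cong (u ∘ suc) j≡) u₂) (trans (cong (2 +_) j≡) (sym s≡))

  u≡0F⇒start : ∀ j → u j ≡ 0F → Σ ℕ λ n → j ≡ start n
  u≡0F⇒start j uj≡0 with inBlock j
  ... | n , first j≡ = n , j≡
  ... | n , second j≡ = ⊥-elim (u-second≢0F n (trans (cong u (sym j≡)) uj≡0))
  ... | n , third _ uj≡top _ = ⊥-elim (top≢0F 1≤m (trans (sym uj≡top) uj≡0))

  no-00 : ∀ j → u j ≡ 0F → u (suc j) ≢ 0F
  no-00 j uj≡0 with u≡0F⇒start j uj≡0
  ... | n , refl = u-second≢0F n

  nonzero-pair : ∀ j → u j ≢ 0F → u (suc j) ≢ 0F → u j ≡ top × u (suc j) ≡ top × u (2 + j) ≡ 0F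
  nonzero-pair j uj≢0 uj₁≢0 with inBlock j
  ... | n , first j≡ = ⊥-elim (uj≢0 (trans (cong u j≡) (u-start n)))
  ... | n , third _ _ s≡ = ⊥-elim (uj₁≢0 (trans (cong u s≡) (u-start (suc n))))
  ... | n , second refl with block n
  ...   | short _ _ s≡ = ⊥-elim (uj₁≢0 (trans (cong u (sym s≡)) (u-start (suc n))))
  ...   | long u≡top u₁ u₂ s≡ = u₁ , u₂ , trans (cong u (sym s≡)) (u-start (suc n))

  -- Desubstitution
  φ-parse : ∀ (s : List A) n → OccursAt (start n) (s ++ [ 0F ]) → Σ (List A) λ v → s ≡ φ v × OccursAt n v
  φ-parse [] n _ = [] , refl , tt
  φ-parse (_ ∷ []) n (_ , u₁≡0 , _) = ⊥-elim (u-second≢0F n u₁≡0)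
  φ-parse (x ∷ c ∷ s) n (u₀ , u₁ , o) with block n
  ... | short u<m u₁≡ s≡ =
        let v , s≡φv , ov = φ-parse s (suc n) (occurs-≡ _ (sym s≡) o) in
        u n ∷ v ,
        trans (cong₂ (λ a b → a ∷ b ∷ s) (trans (sym u₀) (u-start n)) (trans (sym u₁) u₁≡))
              (trans (cong (λ r → 0F ∷ next (u n) ∷ r) s≡φv) (sym (φ-short-∷ (u n) v u<m))) ,
        refl , ov
  φ-parse (x ∷ c ∷ []) n (_ , _ , u₂≡0 , _) | long _ _ u₂≡top _ = ⊥-elim (top≢0F 1≤m (trans (sym u₂≡top) u₂≡0))
  φ-parse (x ∷ c ∷ d ∷ s) n (u₀ , u₁ , u₂ , o) | long u≡top u₁≡ u₂≡ s≡ =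
        let v , s≡φv , ov = φ-parse s (suc n) (occurs-≡ _ (sym s≡) o) in
        top ∷ v ,
        trans (cong₂ _∷_ (trans (sym u₀) (u-start n))
                (cong₂ _∷_ (trans (sym u₁) u₁≡) (cong₂ _∷_ (trans (sym u₂) u₂≡) s≡φv)))
              (sym (φ-top-∷ v)) ,
        u≡top , ov

  start-φ : ∀ n (v : List A) → OccursAt n v → start (n + length v) ≡ start n + length (φ v)
  start-φ n [] _ = trans (cong start (+-identityʳ n)) (sym (+-identityʳ (start n)))
  start-φ n (x ∷ v) (ux , o) = begin
    start (n + suc (length v))                               ≡⟨ cong start (+-suc n (length v)) ⟩
    start (suc n + length v)                                 ≡⟨ start-φ (suc n) v o ⟩
    start (suc n) + length (φ v)                             ≡⟨ cong (_+ length (φ v)) (start-suc n) ⟩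
    start n + (2 + length (extra (u n))) + length (φ v)      ≡⟨ +-assoc (start n) _ _ ⟩
    start n + (2 + length (extra (u n)) + length (φ v))      ≡⟨ cong (λ y → start n + (2 + length (extra y) + length (φ v))) ux ⟩
    start n + (2 + length (extra x) + length (φ v))          ≡⟨ cong (start n +_) (sym (length-φ-∷ x v)) ⟩
    start n + length (φ (x ∷ v))                             ∎
    where open ≡-Reasoning

  occurs-φ : ∀ n (v : List A) → OccursAt n v → OccursAt (start n) (φ v)
  occurs-φ n [] _ = tt
  occurs-φ n (x ∷ v) (ux , o) =
    subst (OccursAt (start n)) (sym (φ-∷ x v))
      (occurs-++⁺ (start n) (0F ∷ next x ∷ extra x) (φ v)
        (subst (λ y → OccursAt (start n) (0F ∷ next y ∷ extra y)) ux (occurs-block n))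
        (occurs-≡ (φ v) (trans (start-suc n) (cong (λ y → start n + (2 + length (extra y))) ux)) (occurs-φ (suc n) v o)))

  ∈L-φ : (v : List A) → v ∈L u → φ v ∈L u
  ∈L-φ v l = let n , o = ∈L⇒occurs l in occurs⇒∈L (φ v) (occurs-φ n v o)

  head-φ-++-0F : ∀ j (v rest : List A) → OccursAt j (φ v ++ 0F ∷ rest) → u j ≡ 0F
  head-φ-++-0F j [] rest (u₀ , _) = u₀
  head-φ-++-0F j (x ∷ v) rest o = proj₁ (subst (OccursAt j) (cong (_++ 0F ∷ rest) (φ-∷ x v)) o)

  desubstitute : ∀ j (v rest : List A) → OccursAt j (φ v ++ 0F ∷ rest) →
                 Σ ℕ λ n → j ≡ start n × OccursAt n v × OccursAt (start (n + length v)) (0F ∷ rest)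
  desubstitute j v rest o with u≡0F⇒start j (head-φ-++-0F j v rest o)
  ... | n , refl with φ-parse (φ v) n (proj₁ (occurs-++⁻ (start n) (φ v ++ [ 0F ]) rest
                                          (subst (OccursAt (start n)) (sym (++-assoc (φ v) [ 0F ] rest)) o)))
  ...   | v' , φv≡φv' , occurs-v' with φ-injective 1≤m v v' φv≡φv'
  ...     | refl = n , refl , occurs-v' ,
                   occurs-≡ (0F ∷ rest) (sym (start-φ n v occurs-v')) (proj₂ (occurs-++⁻ (start n) (φ v) (0F ∷ rest) o))

  u-before-start : ∀ n j → suc j ≡ start (suc n) → u j ≡ next (u n)
  u-before-start n j j₁≡ with block n
  ... | short _ u₁≡ s≡ = trans (cong u (suc-injective (trans j₁≡ s≡))) u₁≡
  ... | long u≡top _ u₂≡ s≡ =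
        trans (cong u (suc-injective (trans j₁≡ s≡))) (trans u₂≡ (sym (trans (cong next u≡top) next-top)))

  desubstitute-left : ∀ j a (v rest : List A) → OccursAt j (a ∷ φ v ++ 0F ∷ rest) →
    Σ ℕ λ n → OccursAt n (u n ∷ v) × next (u n) ≡ a × OccursAt (start (suc n + length v)) (0F ∷ rest)
  desubstitute-left j a v rest (uj≡a , o) with desubstitute (suc j) v rest o
  ... | zero , () , _
  ... | suc n , j₁≡ , occurs-v , occurs-rest =
        n , (refl , occurs-v) , trans (sym (u-before-start n j j₁≡)) uj≡a , occurs-rest

  next-at-start : ∀ n b (rest : List A) → OccursAt (start n) (0F ∷ b ∷ rest) → next (u n) ≡ b
  next-at-start n b rest (_ , u₁ , _) with block n
  ... | short _ u₁≡ _ = trans (sym u₁≡) u₁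
  ... | long u≡top u₁≡ _ _ = trans (cong next u≡top) (trans next-top (trans (sym u₁≡) u₁))

  short-at-start : ∀ n b (rest : List A) → OccursAt (start n) (0F ∷ b ∷ 0F ∷ rest) → toℕ (u n) < m
  short-at-start n b rest (_ , _ , u₂ , _) with block n
  ... | short u<m _ _ = u<m
  ... | long _ _ u₂≡ _ = ⊥-elim (top≢0F 1≤m (trans (sym u₂≡) u₂))

  top-at-start : ∀ n b c (rest : List A) → OccursAt (start n) (0F ∷ b ∷ c ∷ rest) → c ≢ 0F → u n ≡ top
  top-at-start n b c rest (_ , _ , u₂ , _) c≢0 with block n
  ... | short _ _ s≡ = ⊥-elim (c≢0 (trans (sym u₂) (trans (cong u (sym s≡)) (u-start (suc n)))))
  ... | long u≡top _ _ _ = u≡top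

  desubstituteʳ : ∀ (v rest : List A) → (φ v ++ 0F ∷ rest) ∈L u →
    Σ ℕ λ n → (v ++ [ u n ]) ∈L u × OccursAt (start n) (0F ∷ rest)
  desubstituteʳ v rest l with ∈L⇒occurs l
  ... | j , o with desubstitute j v rest o
  ...   | n , _ , occurs-v , occurs-rest =
          n + length v , occurs⇒∈L (v ++ [ _ ]) (occurs-++⁺ n v [ u (n + length v) ] occurs-v (refl , tt)) , occurs-rest

  preimage-right : ∀ (v : List A) b rest → (φ v ++ 0F ∷ b ∷ rest) ∈L u → Σ A λ x → (v ++ [ x ]) ∈L u × next x ≡ b
  preimage-right v b rest l =
    let n , vx∈L , o = desubstituteʳ v (b ∷ rest) l in u n , vx∈L , next-at-start n b rest o

  preimage-bilateral : ∀ a (v : List A) b rest → (a ∷ φ v ++ 0F ∷ b ∷ rest) ∈L u →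
    Σ A λ y → Σ A λ x → (y ∷ v ++ [ x ]) ∈L u × next y ≡ a × next x ≡ b
  preimage-bilateral a v b rest l with ∈L⇒occurs l
  ... | j , o with desubstitute-left j a v (b ∷ rest) o
  ...   | n , (refl , occurs-v) , next≡a , occurs-rest =
          u n , u (suc n + length v) ,
          occurs⇒∈L (u n ∷ v ++ [ _ ]) (refl , occurs-++⁺ (suc n) v [ u (suc n + length v) ] occurs-v (refl , tt)) ,
          next≡a , next-at-start _ b rest occurs-rest

  image-∈L : (y : A) (v : List A) (x : A) → (y ∷ v ++ [ x ]) ∈L u → (next y ∷ φ v ++ 0F ∷ next x ∷ []) ∈L u
  image-∈L y v x l = ∈L-infix (0F ∷ extra y) (next y ∷ φ v ++ 0F ∷ next x ∷ []) (extra x) (subst (_∈L u) φ≡ (∈L-φ _ l))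
    where
    φ≡ : φ (y ∷ v ++ [ x ]) ≡ (0F ∷ extra y) ++ (next y ∷ φ v ++ 0F ∷ next x ∷ []) ++ extra x
    φ≡ = begin
      φ-letter y ++ φ (v ++ [ x ])
        ≡⟨ cong₂ _++_ (φ-letter-∷ʳ-next y) (trans (φ-++ v [ x ]) (cong (φ v ++_) (φ-∷ x []))) ⟩
      (0F ∷ extra y ++ [ next y ]) ++ φ v ++ 0F ∷ next x ∷ extra x ++ []
        ≡⟨ ++-assoc (0F ∷ extra y) [ next y ] _ ⟩
      (0F ∷ extra y) ++ next y ∷ φ v ++ 0F ∷ next x ∷ extra x ++ []
        ≡⟨ cong (λ r → (0F ∷ extra y) ++ next y ∷ r) (sym (++-assoc (φ v) (0F ∷ next x ∷ []) (extra x ++ []))) ⟩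
      (0F ∷ extra y) ++ next y ∷ (φ v ++ 0F ∷ next x ∷ []) ++ extra x ++ []
        ≡⟨ cong (λ r → (0F ∷ extra y) ++ (next y ∷ φ v ++ 0F ∷ next x ∷ []) ++ r) (++-identityʳ (extra x)) ⟩
      (0F ∷ extra y) ++ (next y ∷ φ v ++ 0F ∷ next x ∷ []) ++ extra x
        ∎
      where open ≡-Reasoning

  φ-letter-∈L : (y : A) → [ y ] ∈L u → (0F ∷ next y ∷ extra y) ∈L u
  φ-letter-∈L y l = subst (_∈L u) (trans (++-identityʳ (φ-letter y)) (φ-letter-≡ y)) (∈L-φ [ y ] l)

  letter-∈L-ℕ : ∀ k (k<d : k < suc m) → [ fromℕ< k<d ] ∈L u
  letter-∈L-ℕ zero _ = occurs⇒∈L [ 0F ] (u-start 0 , tt)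
  letter-∈L-ℕ (suc k) k₁<d =
    subst (λ c → [ c ] ∈L u) next≡
      (∈L-infix [ 0F ] [ next y ] (extra y) (φ-letter-∈L y (letter-∈L-ℕ k (m<n⇒m<1+n k<m))))
    where
    k<m : k < m
    k<m = s≤s⁻¹ k₁<d
    y : A
    y = kth k k<m
    next≡ : next y ≡ fromℕ< k₁<d
    next≡ = toℕ-injective (trans (toℕ-next y (subst (_< m) (sym (toℕ-kth k k<m)) k<m))
                                 (trans (cong suc (toℕ-kth k k<m)) (sym (toℕ-fromℕ< k₁<d))))

  letter-∈L : (x : A) → [ x ] ∈L u
  letter-∈L x = subst (λ c → [ c ] ∈L u) (fromℕ<-toℕ x (toℕ<n x)) (letter-∈L-ℕ (toℕ x) (toℕ<n x))

  ¬00∈L : ¬ (0F ∷ 0F ∷ []) ∈L u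
  ¬00∈L l = let j , u₀ , u₁ , _ = ∈L⇒occurs l in no-00 j u₀ u₁

  nonzero-pair-∈L : ∀ c c' → (c ∷ c' ∷ []) ∈L u → c ≢ 0F → c' ≢ 0F → c ≡ top × c' ≡ top
  nonzero-pair-∈L c c' l c≢0 c'≢0 with ∈L⇒occurs l
  ... | j , refl , refl , _ = let u₀ , u₁ , _ = nonzero-pair j c≢0 c'≢0 in u₀ , u₁

  nonzero-triple-∈L : ∀ c c' c'' → (c ∷ c' ∷ c'' ∷ []) ∈L u → c ≢ 0F → c' ≢ 0F → c'' ≡ 0F
  nonzero-triple-∈L c c' c'' l c≢0 c'≢0 with ∈L⇒occurs l
  ... | j , refl , refl , refl , _ = proj₂ (proj₂ (nonzero-pair j c≢0 c'≢0))

  0c∈L : ∀ c → c ≢ 0F → (0F ∷ c ∷ []) ∈L u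
  0c∈L c c≢0 with next-preimage c c≢0
  ... | y , _ , refl =
        ∈L-prefix (0F ∷ next y ∷ []) (extra y) (φ-letter-∈L y (letter-∈L y))

  c0∈L : ∀ c → c ≢ 0F → (c ∷ 0F ∷ []) ∈L u
  c0∈L c c≢0 with next-preimage c c≢0
  ... | y , _ , refl = let x , yx∈L = ∈L-extendʳ [ y ] (letter-∈L y) in
        ∈L-prefix (next y ∷ 0F ∷ []) [ next x ] (image-∈L y [] x yx∈L)

  top-top∈L : (top ∷ top ∷ []) ∈L u
  top-top∈L = ∈L-suffix [ 0F ] (top ∷ top ∷ []) (subst (_∈L u) (φ-top-∷ []) (∈L-φ [ top ] (letter-∈L top)))

  data BextF (k : ℕ) : A → A → Set where
    top∙top : BextF k top top
    k∙b     : ∀ {a b} → toℕ a ≡ k → k < toℕ b → BextF k a b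
    a∙k     : ∀ {a b} → toℕ b ≡ k → k < toℕ a → BextF k a b

  BextF-next : ∀ {k y x} → suc k < m → BextF k y x → BextF (suc k) (next y) (next x)
  BextF-next sk<m top∙top = subst₂ (BextF _) (sym next-top) (sym next-top) top∙top
  BextF-next sk<m (k∙b {y} {x} y≡k k<x) =
    k∙b (trans (toℕ-next y (subst (_< m) (sym y≡k) (<⇒≤ sk<m))) (cong suc y≡k)) (<-next x k<x sk<m)
  BextF-next sk<m (a∙k {y} {x} x≡k k<y) =
    a∙k (trans (toℕ-next x (subst (_< m) (sym x≡k) (<⇒≤ sk<m))) (cong suc x≡k)) (<-next y k<y sk<m)

  BextF-prev : ∀ {k a b} → BextF (suc k) a b → Σ A λ y → Σ A λ x → BextF k y x × next y ≡ a × next x ≡ b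
  BextF-prev top∙top = top , top , top∙top , next-top , next-top
  BextF-prev (k∙b {a} {b} a≡k₁ k₁<b)
    with next-preimage-ℕ a (subst (0 <_) (sym a≡k₁) z<s) | next-preimage-ℕ b (<-trans z<s k₁<b)
  ... | y , refl , y₁≡a | x , refl , x₁≡b =
        y , x , k∙b (suc-injective (trans y₁≡a a≡k₁)) (s≤s⁻¹ (subst (_ <_) (sym x₁≡b) k₁<b)) , refl , refl
  BextF-prev (a∙k {a} {b} b≡k₁ k₁<a)
    with next-preimage-ℕ a (<-trans z<s k₁<a) | next-preimage-ℕ b (subst (0 <_) (sym b≡k₁) z<s)
  ... | y , refl , y₁≡a | x , refl , x₁≡b =
        y , x , a∙k (suc-injective (trans x₁≡b b≡k₁)) (s≤s⁻¹ (subst (_ <_) (sym y₁≡a) k₁<a)) , refl , refl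

  Bext-F₀ : ∀ a b → (a ∷ b ∷ []) ∈L u ⇔ BextF 0 a b
  Bext-F₀ a b = mk⇔ (to a b) from
    where
    to : ∀ a b → (a ∷ b ∷ []) ∈L u → BextF 0 a b
    to 0F 0F l = ⊥-elim (¬00∈L l)
    to 0F (1+F _) _ = k∙b refl z<s
    to (1+F _) 0F _ = a∙k refl z<s
    to (1+F a) (1+F b) l with nonzero-pair-∈L (1+F a) (1+F b) l (λ ()) (λ ())
    ... | a≡top , b≡top = subst₂ (BextF 0) (sym a≡top) (sym b≡top) top∙top
    from : ∀ {a b} → BextF 0 a b → (a ∷ b ∷ []) ∈L u
    from top∙top = top-top∈L
    from (k∙b {a} {b} a≡0 0<b) rewrite toℕ-injective {i = a} {j = 0F} a≡0 = 0c∈L b (0<⇒≢0F b 0<b)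
    from (a∙k {a} {b} b≡0 0<a) rewrite toℕ-injective {i = b} {j = 0F} b≡0 = c0∈L a (0<⇒≢0F a 0<a)

  ∷-F-suc-++ : ∀ k (a b : A) → a ∷ F (suc k) ++ [ b ] ≡ a ∷ φ (F k) ++ 0F ∷ b ∷ []
  ∷-F-suc-++ k a b = cong (a ∷_) (++-assoc (φ (F k)) [ 0F ] [ b ])

  Bext-F : ∀ k → suc k < m → ∀ a b → (a ∷ F k ++ [ b ]) ∈L u ⇔ BextF k a b
  Bext-F zero _ = Bext-F₀
  Bext-F (suc k) sk<m a b = mk⇔ to from
    where
    k₁<m : suc k < m
    k₁<m = <⇒≤ sk<m
    IH : ∀ y x → (y ∷ F k ++ [ x ]) ∈L u ⇔ BextF k y x
    IH = Bext-F k k₁<m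
    to : (a ∷ F (suc k) ++ [ b ]) ∈L u → BextF (suc k) a b
    to l with preimage-bilateral a (F k) b [] (subst (_∈L u) (∷-F-suc-++ k a b) l)
    ... | y , x , yx∈L , refl , refl = BextF-next k₁<m (Equivalence.to (IH y x) yx∈L)
    from : BextF (suc k) a b → (a ∷ F (suc k) ++ [ b ]) ∈L u
    from ext with BextF-prev ext
    ... | y , x , extʸˣ , refl , refl =
          subst (_∈L u) (sym (∷-F-suc-++ k (next y) (next x))) (image-∈L y (F k) x (Equivalence.from (IH y x) extʸˣ))

  BextF-first-≥ : ∀ {k a b} → k < m → BextF k a b → k ≤ toℕ a
  BextF-first-≥ k<m top∙top = <⇒≤ (k<toℕ-top k<m)
  BextF-first-≥ k<m (k∙b a≡k _) = ≤-reflexive (sym a≡k)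
  BextF-first-≥ k<m (a∙k _ k<a) = <⇒≤ k<a

  BextF-first : ∀ {k y x} → BextF k y x → toℕ y < m → k < toℕ x → toℕ y ≡ k
  BextF-first top∙top top<m _ = ⊥-elim (<m⇒≢top top top<m refl)
  BextF-first (k∙b y≡k _) _ _ = y≡k
  BextF-first (a∙k x≡k _) _ k<x = ⊥-elim (<⇒≢ k<x (sym x≡k))

  BextF-with-first : ∀ {k} c → k < m → k ≤ toℕ c → Σ A (BextF k c)
  BextF-with-first {k} c k<m k≤c with m≤n⇒m<n∨m≡n k≤c
  ... | inj₁ k<c = kth k k<m , a∙k (toℕ-kth k k<m) k<c
  ... | inj₂ k≡c = top , k∙b (sym k≡c) (k<toℕ-top k<m)

  BextF-with-last : ∀ {k} c → k < m → k ≤ toℕ c → Σ A λ a → BextF k a c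
  BextF-with-last {k} c k<m k≤c with m≤n⇒m<n∨m≡n k≤c
  ... | inj₁ k<c = kth k k<m , k∙b (toℕ-kth k k<m) k<c
  ... | inj₂ k≡c = top , a∙k (sym k≡c) (k<toℕ-top k<m)

  F-++-right-bound : ∀ k → k < m → ∀ c → (F k ++ [ c ]) ∈L u → k ≤ toℕ c
  F-++-right-bound zero _ _ _ = z≤n
  F-++-right-bound (suc k) k₁<m c l =
    let x , Fx∈L , next≡c = preimage-right (F k) c [] (subst (_∈L u) (++-assoc (φ (F k)) [ 0F ] [ c ]) l)
    in subst (λ c → k < toℕ c) next≡c (<-next x (F-++-right-bound k k<m x Fx∈L) k<m)
    where
    k<m : k < m
    k<m = <⇒≤ k₁<m

  leftExt-F : ∀ k → suc k < m → ∀ c → (c ∷ F k) ∈L u ⇔ k ≤ toℕ c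
  leftExt-F k k₁<m c = mk⇔ to from
    where
    k<m : k < m
    k<m = <⇒≤ k₁<m
    to : (c ∷ F k) ∈L u → k ≤ toℕ c
    to l = let b , l′ = ∈L-extendʳ (c ∷ F k) l in BextF-first-≥ k<m (Equivalence.to (Bext-F k k₁<m c b) l′)
    from : k ≤ toℕ c → (c ∷ F k) ∈L u
    from k≤c = let b , ext = BextF-with-first c k<m k≤c in
      ∈L-prefix (c ∷ F k) [ b ] (Equivalence.from (Bext-F k k₁<m c b) ext)

  rightExt-F : ∀ k → suc k < m → ∀ c → (F k ++ [ c ]) ∈L u ⇔ k ≤ toℕ c
  rightExt-F k k₁<m c = mk⇔ (F-++-right-bound k k<m c) from
    where
    k<m : k < m
    k<m = <⇒≤ k₁<m
    from : k ≤ toℕ c → (F k ++ [ c ]) ∈L u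
    from k≤c = let a , ext = BextF-with-last c k<m k≤c in
      ∈L-suffix [ a ] (F k ++ [ c ]) (Equivalence.from (Bext-F k k₁<m a c) ext)

  BextF-card : ∀ k → k < m → HasCard (λ (p : A × A) → BextF k (proj₁ p) (proj₂ p)) (1 + ((m ∸ k) + (m ∸ k)))
  BextF-card k k<m =
    HasCard-cong (λ p → mk⇔ to (from p))
      (HasCard-⊎ (HasCard-≡ (top , top))
        (HasCard-⊎ (HasCard-map (kth k k<m ,_) (cong proj₂) (HasCard-≥ (suc m) (suc k)))
                   (HasCard-map (_, kth k k<m) (cong proj₁) (HasCard-≥ (suc m) (suc k)))
                   disjoint-k)
        disjoint-top)
    where
    Image₁ Image₂ : A × A → Set
    Image₁ p = Σ A λ b → k < toℕ b × (kth k k<m , b) ≡ p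
    Image₂ p = Σ A λ a → k < toℕ a × (a , kth k k<m) ≡ p
    kth≢top : kth k k<m ≢ top
    kth≢top = <m⇒≢top (kth k k<m) (subst (_< m) (sym (toℕ-kth k k<m)) k<m)
    disjoint-k : ∀ p → Image₁ p → Image₂ p → ⊥
    disjoint-k p (b , k<b , refl) (a , _ , e) = <⇒≢ k<b (sym (trans (cong (toℕ ∘ proj₂) (sym e)) (toℕ-kth k k<m)))
    disjoint-top : ∀ p → p ≡ (top , top) → Image₁ p ⊎ Image₂ p → ⊥
    disjoint-top _ refl (inj₁ (_ , _ , e)) = kth≢top (cong proj₁ e)
    disjoint-top _ refl (inj₂ (_ , _ , e)) = kth≢top (cong proj₂ e)
    to : ∀ {p} → p ≡ (top , top) ⊎ Image₁ p ⊎ Image₂ p → BextF k (proj₁ p) (proj₂ p)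
    to (inj₁ refl) = top∙top
    to (inj₂ (inj₁ (_ , k<b , refl))) = k∙b (toℕ-kth k k<m) k<b
    to (inj₂ (inj₂ (_ , k<a , refl))) = a∙k (toℕ-kth k k<m) k<a
    kth-unique : ∀ {c} → toℕ c ≡ k → kth k k<m ≡ c
    kth-unique c≡k = toℕ-injective (trans (toℕ-kth k k<m) (sym c≡k))
    from : ∀ p → BextF k (proj₁ p) (proj₂ p) → p ≡ (top , top) ⊎ Image₁ p ⊎ Image₂ p
    from _ top∙top = inj₁ refl
    from (a , b) (k∙b a≡k k<b) = inj₂ (inj₁ (b , k<b , cong (_, b) (kth-unique a≡k)))
    from (a , b) (a∙k b≡k k<a) = inj₂ (inj₂ (a , k<a , cong (a ,_) (kth-unique b≡k)))

  F-bilateral-order : ∀ k → suc k < m → BilateralOrder u (F k) 0ℤ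
  F-bilateral-order k k₁<m =
    1 + (t + t) , suc t , suc t ,
    HasCard-cong (λ { (a , b) → ⇔-sym (Bext-F k k₁<m a b) }) (BextF-card k k<m) ,
    HasCard-cong (λ c → ⇔-sym (leftExt-F k k₁<m c)) ≥k-letters ,
    HasCard-cong (λ c → ⇔-sym (rightExt-F k k₁<m c)) ≥k-letters ,
    sym (bilateral-order-zero t)
    where
    k<m : k < m
    k<m = <⇒≤ k₁<m
    t : ℕ
    t = m ∸ k
    ≥k-letters : HasCard (λ (c : A) → k ≤ toℕ c) (suc t)
    ≥k-letters = subst (HasCard _) (+-∸-assoc 1 (<⇒≤ k<m)) (HasCard-≥ (suc m) k)

  BextF⇔ : ∀ {k} i a b → toℕ i ≡ k →
    BextF k a b ⇔ (((a ≡ top) × (b ≡ top)) ⊎ ((a ≡ i) × (toℕ i < toℕ b)) ⊎ ((b ≡ i) × (toℕ i < toℕ a)))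
  BextF⇔ i a b refl = mk⇔ to from
    where
    to : BextF (toℕ i) a b → ((a ≡ top) × (b ≡ top)) ⊎ ((a ≡ i) × (toℕ i < toℕ b)) ⊎ ((b ≡ i) × (toℕ i < toℕ a))
    to top∙top = inj₁ (refl , refl)
    to (k∙b a≡i i<b) = inj₂ (inj₁ (toℕ-injective a≡i , i<b))
    to (a∙k b≡i i<a) = inj₂ (inj₂ (toℕ-injective b≡i , i<a))
    from : ((a ≡ top) × (b ≡ top)) ⊎ ((a ≡ i) × (toℕ i < toℕ b)) ⊎ ((b ≡ i) × (toℕ i < toℕ a)) → BextF (toℕ i) a b
    from (inj₁ (refl , refl)) = top∙top
    from (inj₂ (inj₁ (refl , i<b))) = k∙b refl i<b
    from (inj₂ (inj₂ (refl , i<a))) = a∙k refl i<a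

  -- Bispecial factors with two short left extensions
  IsF : List A → Set
  IsF w = Σ ℕ λ k → suc k < m × w ≡ F k

  ShortLeftExt : List A → A → Set
  ShortLeftExt w a = toℕ a < m × LeftExt u w a

  ShortBispecial : List A → Set
  ShortBispecial w = TwoDistinct (ShortLeftExt w) × TwoDistinct (RightExt u w)

  short-bispecial-∈L : ∀ {w} → ShortBispecial w → w ∈L u
  short-bispecial-∈L {w} (_ , (b , _ , _ , wb∈L , _)) = ∈L-prefix w [ b ] wb∈L

  short-bispecial-head : ∀ c w → ShortBispecial (c ∷ w) → c ≡ 0F
  short-bispecial-head c w (lefts , _) with c ≟ 0F
  ... | yes c≡0 = c≡0
  ... | no c≢0 with TwoDistinct-avoid _≟_ lefts 0F
  ...   | a , a≢0 , a<m , acw∈L =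
          ⊥-elim (<m⇒≢top a a<m (proj₁ (nonzero-pair-∈L a c (∈L-prefix (a ∷ c ∷ []) w acw∈L) a≢0 c≢0)))

  φ-parse-∈L : ∀ ys rest → (0F ∷ ys ++ 0F ∷ rest) ∈L u → Σ (List A) λ v → 0F ∷ ys ≡ φ v
  φ-parse-∈L ys rest l with ∈L⇒occurs l
  ... | j , o with u≡0F⇒start j (proj₁ o)
  ...   | n , refl =
          let v , ys≡φv , _ = φ-parse (0F ∷ ys) n
                (proj₁ (occurs-++⁻ (start n) ((0F ∷ ys) ++ [ 0F ]) rest
                  (subst (OccursAt (start n)) (sym (++-assoc (0F ∷ ys) [ 0F ] rest)) o)))
          in v , ys≡φv

  short-bispecial-φ-prefix : ∀ ys rest → ShortBispecial (ys ++ 0F ∷ rest) → Σ (List A) λ v → ys ≡ φ v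
  short-bispecial-φ-prefix [] rest _ = [] , refl
  short-bispecial-φ-prefix (y ∷ ys) rest sp with short-bispecial-head y (ys ++ 0F ∷ rest) sp
  ... | refl = φ-parse-∈L ys rest (short-bispecial-∈L sp)

  LeftPreimage : List A → A → A → Set
  LeftPreimage v b y = suc (toℕ y) < m × Σ A λ x → (y ∷ v ++ [ x ]) ∈L u × next x ≡ b

  left-preimage : ∀ a v b rest → toℕ a < m → (a ∷ φ v ++ 0F ∷ b ∷ rest) ∈L u →
                  Σ A λ y → LeftPreimage v b y × next y ≡ a
  left-preimage a v b rest a<m l with preimage-bilateral a v b rest l
  ... | y , x , yvx∈L , refl , next-x≡b = y , (subst (_< m) (toℕ-next-< y a<m) a<m , x , yvx∈L , next-x≡b) , refl

  NextShortLeftExt : List A → A → Set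
  NextShortLeftExt v y = suc (toℕ y) < m × LeftExt u v y

  LeftPreimage⇒NextShort : ∀ {v b} y → LeftPreimage v b y → NextShortLeftExt v y
  LeftPreimage⇒NextShort {v} y (y₁<m , x , yvx∈L , _) = y₁<m , ∈L-prefix (y ∷ v) [ x ] yvx∈L

  short-bispecial-from-next-short : ∀ {v} → TwoDistinct (NextShortLeftExt v) → TwoDistinct (RightExt u v) → ShortBispecial v
  short-bispecial-from-next-short lefts rights = TwoDistinct-map (λ _ (y₁<m , l) → <⇒≤ y₁<m , l) lefts , rights

  lefts-φ-0F : ∀ v → TwoDistinct (ShortLeftExt (φ v ++ [ 0F ])) → TwoDistinct (NextShortLeftExt v)
  lefts-φ-0F v = TwoDistinct-pullback next left
    where
    left : ∀ a → ShortLeftExt (φ v ++ [ 0F ]) a → Σ A λ y → NextShortLeftExt v y × next y ≡ a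
    left a (a<m , l) with ∈L-extendʳ _ l
    ... | b , l′ with left-preimage a v b [] a<m (subst (_∈L u) (cong (a ∷_) (++-assoc (φ v) [ 0F ] [ b ])) l′)
    ...   | y , (y₁<m , x , yvx∈L , _) , next≡a = y , (y₁<m , ∈L-prefix (y ∷ v) [ x ] yvx∈L) , next≡a

  rights-φ-0F : ∀ v → TwoDistinct (RightExt u (φ v ++ [ 0F ])) → TwoDistinct (RightExt u v)
  rights-φ-0F v = TwoDistinct-pullback next λ b l → preimage-right v b [] (subst (_∈L u) (++-assoc (φ v) [ 0F ] [ b ]) l)

  short-bispecial-∷ʳ-0F : ∀ ys → ShortBispecial (ys ++ [ 0F ]) →
                  (∀ v → length v ≤ length ys → ShortBispecial v → IsF v) → IsF (ys ++ [ 0F ])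
  short-bispecial-∷ʳ-0F ys sp IH with short-bispecial-φ-prefix ys [] sp
  ... | v , refl = suc k , k₂<m , cong (λ v → φ v ++ [ 0F ]) v≡Fk
    where
    lefts : TwoDistinct (NextShortLeftExt v)
    lefts = lefts-φ-0F v (proj₁ sp)
    IHv : IsF v
    IHv = IH v (length-≤-φ v) (short-bispecial-from-next-short lefts (rights-φ-0F v (proj₂ sp)))
    k : ℕ
    k = proj₁ IHv
    v≡Fk : v ≡ F k
    v≡Fk = proj₂ (proj₂ IHv)
    k≤ : ∀ c → (c ∷ v) ∈L u → k ≤ toℕ c
    k≤ c = Equivalence.to (leftExt-F k (proj₁ (proj₂ IHv)) c) ∘ subst (λ v → (c ∷ v) ∈L u) v≡Fk
    k₂<m : suc (suc k) < m
    k₂<m = let y , y' , y≢y' , (y₁<m , yv∈L) , (y'₁<m , y'v∈L) = lefts in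
      two-distinct-≥⇒2+< (k≤ y yv∈L) (k≤ y' y'v∈L) (y≢y' ∘ toℕ-injective) y₁<m y'₁<m

  rights-φ-0-top : ∀ v → (φ v ++ 0F ∷ top ∷ top ∷ []) ∈L u → (φ v ++ 0F ∷ top ∷ 0F ∷ []) ∈L u →
                   TwoDistinct (RightExt u v)
  rights-φ-0-top v ltop l0 with desubstituteʳ v (top ∷ top ∷ []) ltop | desubstituteʳ v (top ∷ 0F ∷ []) l0
  ... | n , vx∈L , o | n' , vx'∈L , o' = u n , u n' , x≢x' , vx∈L , vx'∈L
    where
    x≢x' : u n ≢ u n'
    x≢x' e = <m⇒≢top (u n') (short-at-start n' top [] o') (trans (sym e) (top-at-start n top top [] o (top≢0F 1≤m)))

  ¬short-bispecial-φ-0-top : ∀ v → ShortBispecial (φ v ++ 0F ∷ top ∷ []) →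
    (φ v ++ 0F ∷ top ∷ top ∷ []) ∈L u → (φ v ++ 0F ∷ top ∷ 0F ∷ []) ∈L u → (ShortBispecial v → IsF v) → ⊥
  ¬short-bispecial-φ-0-top v (lefts , _) ltop l0 IH
    with TwoDistinct-pullback next (λ a (a<m , l) → left-preimage a v top [] a<m l) lefts
  ... | lefts′@(y , y' , y≢y' , py , py')
        with IH (short-bispecial-from-next-short (TwoDistinct-map LeftPreimage⇒NextShort lefts′) (rights-φ-0-top v ltop l0))
  ...   | k , k₁<m , refl = y≢y' (toℕ-injective (trans (≡k y py) (sym (≡k y' py'))))
    where
    ≡k : ∀ y → LeftPreimage (F k) top y → toℕ y ≡ k
    ≡k y (y₁<m , x , yFx∈L , next-x≡top) =
      BextF-first (Equivalence.to (Bext-F k k₁<m y x) yFx∈L) (<⇒≤ y₁<m)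
                  (s≤s⁻¹ (≤-trans k₁<m (next≡top⇒ x next-x≡top)))

  ¬short-bispecial-∷ʳ-top : ∀ ys → ShortBispecial (ys ++ [ top ]) →
    ((ys ++ [ top ]) ++ [ top ]) ∈L u → ((ys ++ [ top ]) ++ [ 0F ]) ∈L u →
    (∀ v → length v ≤ length ys → ShortBispecial v → IsF v) → ⊥
  ¬short-bispecial-∷ʳ-top ys sp ltop l0 IH with initLast ys
  ... | [] = top≢0F 1≤m (short-bispecial-head top [] sp)
  ... | ys' ∷ʳ′ z with z ≟ 0F
  ...   | no z≢0 =
          top≢0F 1≤m (nonzero-triple-∈L z top top
            (∈L-suffix ys' (z ∷ top ∷ top ∷ []) (subst (_∈L u) (∷ʳ-∷ʳ-∷ʳ ys' z top top) ltop)) z≢0 (top≢0F 1≤m))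
  ...   | yes refl with short-bispecial-φ-prefix ys' [ top ] (subst ShortBispecial (∷ʳ-∷ʳ ys' 0F top) sp)
  ...     | v , refl =
            ¬short-bispecial-φ-0-top v (subst ShortBispecial (∷ʳ-∷ʳ (φ v) 0F top) sp)
              (subst (_∈L u) (∷ʳ-∷ʳ-∷ʳ (φ v) 0F top top) ltop) (subst (_∈L u) (∷ʳ-∷ʳ-∷ʳ (φ v) 0F top 0F) l0)
              (IH v (≤-trans (length-≤-φ v) (length-++-≤ˡ (φ v))))

  ¬short-bispecial-∷ʳ-nonzero : ∀ ys z → z ≢ 0F → ShortBispecial (ys ++ [ z ]) →
    (∀ v → length v ≤ length ys → ShortBispecial v → IsF v) → ⊥
  ¬short-bispecial-∷ʳ-nonzero ys z z≢0 sp IH with TwoDistinct-avoid _≟_ (proj₂ sp) 0F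
  ... | c , c≢0 , l with nonzero-pair-∈L z c (∈L-suffix ys (z ∷ c ∷ []) (subst (_∈L u) (∷ʳ-∷ʳ ys z c) l)) z≢0 c≢0
  ...   | refl , refl with TwoDistinct-avoid _≟_ (proj₂ sp) top
  ...     | c' , c'≢top , l' with c' ≟ 0F
  ...       | yes refl = ¬short-bispecial-∷ʳ-top ys sp l l' IH
  ...       | no c'≢0 =
              c'≢top (proj₂ (nonzero-pair-∈L top c'
                (∈L-suffix ys (top ∷ c' ∷ []) (subst (_∈L u) (∷ʳ-∷ʳ ys top c') l')) (top≢0F 1≤m) c'≢0))

  short-bispecial-∷ʳ : ∀ ys z → ShortBispecial (ys ++ [ z ]) →
               (∀ v → length v ≤ length ys → ShortBispecial v → IsF v) → IsF (ys ++ [ z ])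
  short-bispecial-∷ʳ ys z sp IH with z ≟ 0F
  ... | yes refl = short-bispecial-∷ʳ-0F ys sp IH
  ... | no z≢0 = ⊥-elim (¬short-bispecial-∷ʳ-nonzero ys z z≢0 sp IH)

  short-bispecial⇒F : 1 < m → ∀ n (w : List A) → length w ≤ n → ShortBispecial w → IsF w
  short-bispecial⇒F 1<m n w len sp with initLast w
  ... | [] = 0 , 1<m , refl
  short-bispecial⇒F 1<m zero .(ys ++ [ z ]) len sp | ys ∷ʳ′ z = ⊥-elim (n≮0 (subst (_≤ 0) (length-∷ʳ ys z) len))
  short-bispecial⇒F 1<m (suc n) .(ys ++ [ z ]) len sp | ys ∷ʳ′ z =
    short-bispecial-∷ʳ ys z sp λ v v≤ys →
      short-bispecial⇒F 1<m n v (≤-trans v≤ys (s≤s⁻¹ (subst (_≤ suc n) (length-∷ʳ ys z) len)))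

proposition4 : (m : ℕ) → 3 ≤ suc m → (u : Word m) → IsFixedPoint u →
    (w : List (Fin (suc m))) → Bispecial u w →
    (Σ (Fin (suc m)) λ a → Σ (Fin (suc m)) λ a' → (a ≡ a' → ⊥) ×
       toℕ a < m × toℕ a' < m × LeftExt u w a × LeftExt u w a') →
    (i : Fin (suc m)) → LeftExt u w i → ((a : Fin (suc m)) → LeftExt u w a → toℕ i ≤ toℕ a) →
    (w ≡ F (toℕ i)) ×
    ((a b : Fin (suc m)) → BExt u w (a , b) ⇔
       (((a ≡ fromℕ m) × (b ≡ fromℕ m)) ⊎ ((a ≡ i) × (toℕ i < toℕ b)) ⊎ ((b ≡ i) × (toℕ i < toℕ a)))) ×
    BilateralOrder u w 0ℤ ×
    (toℕ i ≤ m ∸ 2)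
proposition4 m (s≤s 1<m) u fp w (_ , _ , rights) (a , a' , a≢a' , a<m , a'<m , la , la') i li i-min =
  trans w≡Fk (cong F (sym i≡k)) ,
  (λ a b → BextF⇔ i a b i≡k ⇔-∘ (Bext-F k k₁<m a b ⇔-∘ subst-⇔ (λ v → BExt u v (a , b)) w≡Fk)) ,
  subst (λ v → BilateralOrder u v 0ℤ) (sym w≡Fk) (F-bilateral-order k k₁<m) ,
  subst (_≤ m ∸ 2) (sym i≡k) (∸-monoˡ-≤ 2 k₁<m)
  where
  open Letters {m}
  open FixedPoint (<⇒≤ 1<m) u fp
  F-form : IsF w
  F-form = short-bispecial⇒F 1<m (length w) w ≤-refl ((a , a' , a≢a' , (a<m , la) , (a'<m , la')) , rights)
  k : ℕ
  k = proj₁ F-form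
  k₁<m : suc k < m
  k₁<m = proj₁ (proj₂ F-form)
  w≡Fk : w ≡ F k
  w≡Fk = proj₂ (proj₂ F-form)
  leftExt-w : ∀ c → LeftExt u w c ⇔ k ≤ toℕ c
  leftExt-w c = leftExt-F k k₁<m c ⇔-∘ subst-⇔ (λ v → LeftExt u v c) w≡Fk
  i≡k : toℕ i ≡ k
  i≡k = ≤-antisym i≤k (Equivalence.to (leftExt-w i) li)
    where
    k<m : k < m
    k<m = <⇒≤ k₁<m
    i≤k : toℕ i ≤ k
    i≤k = subst (toℕ i ≤_) (toℕ-kth k k<m)
            (i-min (kth k k<m) (Equivalence.from (leftExt-w _) (≤-reflexive (sym (toℕ-kth k k<m)))))
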